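{- Let $G$ be a graph, $s,t\in V(G)$ and $V'\subseteq V(G)$. If there exist sets $S,T\subseteq V(G)$ that serve as a certificate for the $st$-separator minimality of $V'$, then there exists a minimal $st$-separator of $G$ that contains all vertices of $V'$.
   Context: All graphs are finite, simple and undirected. An $st$-separator is a set $Z\subseteq V(G)\setminus\{s,t\}$ such that $G-Z$ has no $s$–$t$ path; it is minimal if no proper subset is an $st$-separator. Sets $S,T\subseteq V(G)$ serve as a certificate for the $st$-separator minimality of $V'$ if: $s\in S$, $t\in T$, $S\cap T=\emptyset$, $G[S]$ and $G[T]$ are connected, there is no edge with one endpoint in $S$ and the other in $T$, and for every $v\in V'$ the subgraph $G[S\cup T\cup\{v\}]$ is connected (in particular $V'\cap(S\cup T)=\emptyset$). -}

module Defs where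

open import Data.Nat using (ℕ)
open import Data.Fin using (Fin)
open import Data.Bool using (Bool; true; false)
open import Data.Fin.Subset using (Subset; _∈_; _∉_; _⊆_; _⊂_; _∪_; _∩_; ∁; ⁅_⁆; Empty)
open import Data.Product using (_×_; ∃-syntax)
open import Relation.Nullary using (¬_)
open import Relation.Binary.PropositionalEquality using (_≡_)

record Graph (n : ℕ) : Set where
  field
    adj       : Fin n → Fin n → Bool
    adj-sym   : ∀ u v → adj u v ≡ adj v u
    adj-irrefl : ∀ u → adj u u ≡ false
open Graph public

Adj : ∀ {n} → Graph n → Fin n → Fin n → Set
Adj G u v = adj G u v ≡ true

data WalkIn {n} (G : Graph n) (X : Subset n) : Fin n → Fin n → Set where
  [_]  : ∀ {u} → u ∈ X → WalkIn G X u u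
  _∷_  : ∀ {u w v} → (u ∈ X × Adj G u w) → WalkIn G X w v → WalkIn G X u v

Connected : ∀ {n} → Graph n → Subset n → Set
Connected G X = ∀ {u v} → u ∈ X → v ∈ X → WalkIn G X u v

IsSeparator : ∀ {n} → Graph n → Fin n → Fin n → Subset n → Set
IsSeparator G s t Z = s ∉ Z × t ∉ Z × ¬ WalkIn G (∁ Z) s t

IsMinimalSeparator : ∀ {n} → Graph n → Fin n → Fin n → Subset n → Set
IsMinimalSeparator G s t Z =
  IsSeparator G s t Z × (∀ Z′ → Z′ ⊂ Z → ¬ IsSeparator G s t Z′)

IsCertificate : ∀ {n} → Graph n → Fin n → Fin n → Subset n → Subset n → Subset n → Set
IsCertificate G s t V′ S T =
  s ∈ S × t ∈ T × Empty (S ∩ T)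
  × Connected G S × Connected G T
  × (∀ u v → u ∈ S → v ∈ T → ¬ Adj G u v)
  × (∀ v → v ∈ V′ → Connected G (S ∪ T ∪ ⁅ v ⁆))

{-# OPTIONS --safe #-}
module Submission where

-- Let C be the component of t in G − N[S], where N[S] is S with its neighbours
-- (far S is the vertex set of G − N[S]); T ⊆ C since T is connected and misses
-- N[S]. A neighbour of C outside C lies in N[S] but, being adjacent to C, not in
-- S; so Z = N(C) ∖ C separates s from t and each of its vertices has neighbours
-- in both connected sides S and C, which makes Z minimal. A vertex v ∈ V′ links
-- S to T with no S–T edges, so it is adjacent to S (hence v ∉ C) and to T ⊆ C,
-- i.e. v ∈ Z.

open import Defs
open import Data.Nat using (ℕ; zero; suc; _≤_; z≤n; s≤s)
open import Data.Nat.Properties using (≤-trans; <-irrefl)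
open import Data.Nat.GeneralisedArithmetic using (fold)
open import Data.Fin using (Fin)
open import Data.Fin.Subset using (Subset; _⊆_; _∈_; _∉_; _⊂_; _∪_; _∩_; ∁; ⁅_⁆; Empty; ∣_∣)
open import Data.Fin.Subset.Properties
open import Data.Fin.Properties using (any?)
open import Data.Bool using (true; _≟_)
open import Data.Bool.Properties using (T-≡)
open import Data.Vec using (tabulate)
open import Data.Vec.Properties using (lookup∘tabulate; []=⇒lookup; lookup⇒[]=)
open import Data.Product using (_×_; ∃₂; ∃-syntax; _,_)
open import Data.Sum using (_⊎_; inj₁; inj₂)
open import Function using (_∘_; Equivalence)
open import Relation.Nullary using (¬_; yes; no; contradiction)
open import Relation.Nullary.Decidable using (_×-dec_; isYes; toWitness; fromWitness)
open import Relation.Unary using (Pred; Decidable)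
open import Relation.Binary.PropositionalEquality using (_≡_; refl; sym; trans; cong; subst)

private
  variable
    n : ℕ

toSubset : ∀ {ℓ} {P : Pred (Fin n) ℓ} → Decidable P → Subset n
toSubset P? = tabulate (isYes ∘ P?)

module _ {ℓ} {P : Pred (Fin n) ℓ} (P? : Decidable P) where

  ∈-toSubset⁺ : ∀ {x} → P x → x ∈ toSubset P?
  ∈-toSubset⁺ {x} px =
    lookup⇒[]= x _ (trans (lookup∘tabulate _ x) (Equivalence.to T-≡ (fromWitness {a? = P? x} px)))

  ∈-toSubset⁻ : ∀ {x} → x ∈ toSubset P? → P x
  ∈-toSubset⁻ {x} x∈ =
    toWitness {a? = P? x} (Equivalence.from T-≡ (trans (sym (lookup∘tabulate _ x)) ([]=⇒lookup x∈)))

x∈p∪q∪⁅y⁆⇒x≡y : ∀ {p q : Subset n} {x y} → x ∈ p ∪ q ∪ ⁅ y ⁆ → x ∉ p → x ∉ q → x ≡ y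
x∈p∪q∪⁅y⁆⇒x≡y {p = p} {q} {y = y} x∈ x∉p x∉q with x∈p∪q⁻ p _ x∈
... | inj₁ x∈p = contradiction x∈p x∉p
... | inj₂ x∈q∪y with x∈p∪q⁻ q _ x∈q∪y
...   | inj₁ x∈q = contradiction x∈q x∉q
...   | inj₂ x∈y = x∈⁅y⁆⇒x≡y y x∈y

⊆∧⊄⇒≡ : ∀ {p q : Subset n} → p ⊆ q → ¬ p ⊂ q → p ≡ q
⊆∧⊄⇒≡ {p = p} p⊆q p⊄q = ⊆-antisym p⊆q q⊆p
  where
  q⊆p : _ ⊆ p
  q⊆p {x} x∈q with x ∈? p
  ... | yes x∈p = x∈p
  ... | no x∉p = contradiction ((λ {y} → p⊆q {y}) , x , x∈q , x∉p) p⊄q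

fold-induction : ∀ {A : Set} (P : A → Set) {f : A → A} {a : A} →
  P a → (∀ {b} → P b → P (f b)) → ∀ k → P (fold a f k)
fold-induction P Pa step zero = Pa
fold-induction P Pa step (suc k) = step (fold-induction P Pa step k)

module _ (f : Subset n → Subset n) (inflationary : ∀ {p} → p ⊆ f p) where

  fold-grows-or-stops : ∀ p k → k ≤ ∣ fold p f k ∣ ⊎ f (fold p f k) ≡ fold p f k
  fold-grows-or-stops p zero = inj₁ z≤n
  fold-grows-or-stops p (suc k) with fold-grows-or-stops p k
  ... | inj₂ stops = inj₂ (cong f stops)
  ... | inj₁ grows with fold p f k ⊂? f (fold p f k)
  ...   | yes ⊂f = inj₁ (≤-trans (s≤s grows) (p⊂q⇒∣p∣<∣q∣ ⊂f))
  ...   | no ⊄f = inj₂ (cong f (sym (⊆∧⊄⇒≡ inflationary ⊄f)))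

  fold-stabilises : ∀ p → f (fold p f (suc n)) ≡ fold p f (suc n)
  fold-stabilises p with fold-grows-or-stops p (suc n)
  ... | inj₁ grows = contradiction (≤-trans grows (∣p∣≤n (fold p f (suc n)))) (<-irrefl refl)
  ... | inj₂ stops = stops

module _ (G : Graph n) where

  Adj-sym : ∀ {u v} → Adj G u v → Adj G v u
  Adj-sym {u} {v} u~v = trans (adj-sym G v u) u~v

  neighbours : Subset n → Subset n
  neighbours R = toSubset (λ x → any? (λ y → (y ∈? R) ×-dec (adj G x y ≟ true)))

  ∈-neighbours⁺ : ∀ {R x y} → y ∈ R → Adj G x y → x ∈ neighbours R
  ∈-neighbours⁺ y∈R x~y = ∈-toSubset⁺ _ (_ , y∈R , x~y)

  ∈-neighbours⁻ : ∀ {R x} → x ∈ neighbours R → ∃[ y ] (y ∈ R × Adj G x y)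
  ∈-neighbours⁻ = ∈-toSubset⁻ _

  neighbours-mono : ∀ {R R′} → R ⊆ R′ → neighbours R ⊆ neighbours R′
  neighbours-mono R⊆R′ x∈ with ∈-neighbours⁻ x∈
  ... | y , y∈R , x~y = ∈-neighbours⁺ (R⊆R′ y∈R) x~y

  boundary : Subset n → Subset n
  boundary R = ∁ R ∩ neighbours R

  ⊆∁boundary : ∀ {R} → R ⊆ ∁ (boundary R)
  ⊆∁boundary x∈R = x∉p⇒x∈∁p (λ x∈∂R → x∈∁p⇒x∉p (p∩q⊆p _ _ x∈∂R) x∈R)

  walk-head : ∀ {X a b} → WalkIn G X a b → a ∈ X
  walk-head [ a∈X ] = a∈X
  walk-head ((a∈X , _) ∷ _) = a∈X

  walk-mono : ∀ {X Y a b} → X ⊆ Y → WalkIn G X a b → WalkIn G Y a b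
  walk-mono X⊆Y [ a∈X ] = [ X⊆Y a∈X ]
  walk-mono X⊆Y ((a∈X , a~w) ∷ p) = (X⊆Y a∈X , a~w) ∷ walk-mono X⊆Y p

  infixr 5 _++_

  _++_ : ∀ {X a b c} → WalkIn G X a b → WalkIn G X b c → WalkIn G X a c
  [ _ ] ++ q = q
  (step ∷ p) ++ q = step ∷ (p ++ q)

  reverse : ∀ {X a b} → WalkIn G X a b → WalkIn G X b a
  reverse [ a∈X ] = [ a∈X ]
  reverse ((a∈X , a~w) ∷ p) = reverse p ++ (walk-head p , Adj-sym a~w) ∷ [ a∈X ]

  walk-enters : ∀ {X Y a b} → WalkIn G X a b → a ∉ Y → b ∈ Y →
    ∃₂ λ x y → x ∈ X × x ∉ Y × y ∈ Y × Adj G x y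
  walk-enters [ _ ] a∉Y a∈Y = contradiction a∈Y a∉Y
  walk-enters {Y = Y} (_∷_ {w = w} (a∈X , a~w) p) a∉Y b∈Y with w ∈? Y
  ... | yes w∈Y = _ , w , a∈X , a∉Y , w∈Y , a~w
  ... | no w∉Y = walk-enters p w∉Y b∈Y

  boundary-separates : ∀ {C s t} → t ∈ C → s ∉ C → s ∉ boundary C →
    IsSeparator G s t (boundary C)
  boundary-separates {C} t∈C s∉C s∉∂C = s∉∂C , t∉∂C , no-walk
    where
    t∉∂C : _ ∉ boundary C
    t∉∂C = x∈∁p⇒x∉p (⊆∁boundary t∈C)
    no-walk : ¬ WalkIn G (∁ (boundary C)) _ _
    no-walk w with walk-enters w s∉C t∈C
    ... | x , y , x∉∂C , x∉C , y∈C , x~y =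
      x∈∁p⇒x∉p x∉∂C (x∈p∩q⁺ (x∉p⇒x∈∁p x∉C , ∈-neighbours⁺ y∈C x~y))

  full-sides⇒minimal : ∀ {s t X Y Z} → IsSeparator G s t Z → s ∈ X → t ∈ Y →
    Connected G X → Connected G Y → X ⊆ ∁ Z → Y ⊆ ∁ Z →
    Z ⊆ neighbours X → Z ⊆ neighbours Y → IsMinimalSeparator G s t Z
  full-sides⇒minimal {s} {t} {X} {Y} {Z} sep s∈X t∈Y X-conn Y-conn X⊆∁Z Y⊆∁Z Z⊆NX Z⊆NY =
    sep , smaller-fails
    where
    smaller-fails : ∀ Z′ → Z′ ⊂ Z → ¬ IsSeparator G s t Z′
    smaller-fails Z′ (Z′⊆Z , z , z∈Z , z∉Z′) (_ , _ , no-walk)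
      with ∈-neighbours⁻ (Z⊆NX z∈Z) | ∈-neighbours⁻ (Z⊆NY z∈Z)
    ... | x , x∈X , z~x | y , y∈Y , z~y =
      no-walk (walk-mono X⊆∁Z′ (X-conn s∈X x∈X)
               ++ (X⊆∁Z′ x∈X , Adj-sym z~x)
               ∷ ((x∉p⇒x∈∁p z∉Z′ , z~y) ∷ walk-mono Y⊆∁Z′ (Y-conn y∈Y t∈Y)))
      where
      ∁Z⊆∁Z′ : ∁ Z ⊆ ∁ Z′
      ∁Z⊆∁Z′ = p⊆q⇒∁p⊇∁q (λ {v} → Z′⊆Z {v})
      X⊆∁Z′ : X ⊆ ∁ Z′
      X⊆∁Z′ = ∁Z⊆∁Z′ ∘ X⊆∁Z
      Y⊆∁Z′ : Y ⊆ ∁ Z′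
      Y⊆∁Z′ = ∁Z⊆∁Z′ ∘ Y⊆∁Z

  extend : Subset n → Subset n → Subset n
  extend A R = R ∪ (A ∩ neighbours R)

  -- Extension is inflationary, so by fold-stabilises it reaches its fixed point,
  -- the component of t in G[A], within n + 1 rounds.
  component : Subset n → Fin n → Subset n
  component A t = fold ⁅ t ⁆ (extend A) (suc n)

  module _ {A : Subset n} {t : Fin n} where

    private
      C : Subset n
      C = component A t

    t∈component : t ∈ C
    t∈component = fold-induction (t ∈_) (x∈⁅x⁆ t) (p⊆p∪q _) (suc n)

    component-closed : ∀ {x y} → y ∈ C → x ∈ A → Adj G x y → x ∈ C
    component-closed {x} y∈C x∈A x~y =
      subst (x ∈_) (fold-stabilises (extend A) (p⊆p∪q _) ⁅ t ⁆)
        (x∈p∪q⁺ (inj₂ (x∈p∩q⁺ (x∈A , ∈-neighbours⁺ y∈C x~y))))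

    component⊆ : t ∈ A → C ⊆ A
    component⊆ t∈A = fold-induction (_⊆ A) ⁅t⁆⊆A extend-⊆ (suc n)
      where
      ⁅t⁆⊆A : ⁅ t ⁆ ⊆ A
      ⁅t⁆⊆A x∈⁅t⁆ with x∈⁅y⁆⇒x≡y t x∈⁅t⁆
      ... | refl = t∈A
      extend-⊆ : ∀ {R} → R ⊆ A → extend A R ⊆ A
      extend-⊆ {R} R⊆A x∈ with x∈p∪q⁻ R _ x∈
      ... | inj₁ x∈R = R⊆A x∈R
      ... | inj₂ x∈A∩NR = p∩q⊆p A _ x∈A∩NR

    Reaches : Subset n → Set
    Reaches R = ∀ {x} → x ∈ R → WalkIn G R x t

    component-reaches : Reaches C
    component-reaches = fold-induction Reaches ⁅t⁆-reaches extend-reaches (suc n)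
      where
      ⁅t⁆-reaches : Reaches ⁅ t ⁆
      ⁅t⁆-reaches x∈⁅t⁆ with x∈⁅y⁆⇒x≡y t x∈⁅t⁆
      ... | refl = [ x∈⁅t⁆ ]
      extend-reaches : ∀ {R} → Reaches R → Reaches (extend A R)
      extend-reaches {R} R-reaches x∈ with x∈p∪q⁻ R _ x∈
      ... | inj₁ x∈R = walk-mono (p⊆p∪q _) (R-reaches x∈R)
      ... | inj₂ x∈A∩NR with ∈-neighbours⁻ (p∩q⊆q A _ x∈A∩NR)
      ...   | y , y∈R , x~y = (x∈ , x~y) ∷ walk-mono (p⊆p∪q _) (R-reaches y∈R)

    component-connected : Connected G C
    component-connected u∈C v∈C = component-reaches u∈C ++ reverse (component-reaches v∈C)

    walk-stays-in-component : ∀ {a b} → WalkIn G A a b → a ∈ C → b ∈ C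
    walk-stays-in-component [ _ ] a∈C = a∈C
    walk-stays-in-component ((_ , a~w) ∷ p) a∈C =
      walk-stays-in-component p (component-closed a∈C (walk-head p) (Adj-sym a~w))

    connected⊆component : ∀ {X} → Connected G X → X ⊆ A → t ∈ X → X ⊆ C
    connected⊆component X-conn X⊆A t∈X x∈X =
      walk-stays-in-component (walk-mono X⊆A (X-conn t∈X x∈X)) t∈component

    boundary-component⊆∁ : boundary C ⊆ ∁ A
    boundary-component⊆∁ z∈∂C with x∈p∩q⁻ _ _ z∈∂C
    ... | z∈∁C , z∈NC with ∈-neighbours⁻ z∈NC
    ...   | y , y∈C , z~y =
      x∉p⇒x∈∁p (λ z∈A → x∈∁p⇒x∉p z∈∁C (component-closed y∈C z∈A z~y))

  far : Subset n → Subset n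
  far S = ∁ (S ∪ neighbours S)

  module _ {S : Subset n} {t : Fin n} (t∈far : t ∈ far S) where

    private
      C : Subset n
      C = component (far S) t

    far-component-avoids : S ∪ neighbours S ⊆ ∁ C
    far-component-avoids x∈ = p⊆q⇒∁p⊇∁q (component⊆ t∈far) (x∉p⇒x∈∁p (x∈p⇒x∉∁p x∈))

    boundary-far-component⊆ : boundary C ⊆ neighbours S ∩ ∁ S
    boundary-far-component⊆ {z} z∈∂C with ∈-neighbours⁻ (p∩q⊆q _ _ z∈∂C)
    ... | y , y∈C , z~y = x∈p∩q⁺ (z∈NS , x∉p⇒x∈∁p z∉S)
      where
      z∉S : z ∉ S
      z∉S z∈S =
        x∈∁p⇒x∉p (far-component-avoids (x∈p∪q⁺ (inj₂ (∈-neighbours⁺ z∈S (Adj-sym z~y))))) y∈C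
      z∈NS : z ∈ neighbours S
      z∈NS with x∈p∪q⁻ S _ (x∉∁p⇒x∈p (x∈∁p⇒x∉p (boundary-component⊆∁ z∈∂C)))
      ... | inj₁ z∈S = contradiction z∈S z∉S
      ... | inj₂ z∈NS = z∈NS

    far-component-boundary-minimal : ∀ {s} → s ∈ S → Connected G S →
      IsMinimalSeparator G s t (boundary C)
    far-component-boundary-minimal {s} s∈S S-connected =
      full-sides⇒minimal separates s∈S t∈component S-connected component-connected
        S⊆∁∂C ⊆∁boundary (p∩q⊆p _ _ ∘ boundary-far-component⊆) (p∩q⊆q _ _)
      where
      S⊆∁∂C : S ⊆ ∁ (boundary C)
      S⊆∁∂C x∈S =
        x∉p⇒x∈∁p (λ x∈∂C → x∈∁p⇒x∉p (p∩q⊆q _ _ (boundary-far-component⊆ x∈∂C)) x∈S)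
      separates : IsSeparator G s t (boundary C)
      separates = boundary-separates t∈component
        (x∈∁p⇒x∉p (far-component-avoids (x∈p∪q⁺ (inj₁ s∈S)))) (x∈∁p⇒x∉p (S⊆∁∂C s∈S))

  separated⊆far : ∀ {S T} → Empty (S ∩ T) → (∀ u w → u ∈ S → w ∈ T → ¬ Adj G u w) →
    T ⊆ far S
  separated⊆far {S} S∩T=∅ no-edge {x} x∈T = x∉p⇒x∈∁p (x∉S∪NS ∘ x∈p∪q⁻ S _)
    where
    x∉S∪NS : x ∈ S ⊎ x ∈ neighbours S → _
    x∉S∪NS (inj₁ x∈S) = S∩T=∅ (x , x∈p∩q⁺ (x∈S , x∈T))
    x∉S∪NS (inj₂ x∈NS) with ∈-neighbours⁻ x∈NS
    ... | u , u∈S , x~u = no-edge u x u∈S x∈T (Adj-sym x~u)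

  linking-vertex-adjacent : ∀ {S T v a b} → Empty (S ∩ T) →
    (∀ u w → u ∈ S → w ∈ T → ¬ Adj G u w) → a ∈ S → b ∈ T →
    WalkIn G (S ∪ T ∪ ⁅ v ⁆) a b → v ∈ neighbours S × v ∈ neighbours T
  linking-vertex-adjacent {S} {T} S∩T=∅ no-edge a∈S b∈T w = adjacent-to-S , adjacent-to-T
    where
    disjoint : ∀ {x} → x ∈ S → x ∉ T
    disjoint x∈S x∈T = S∩T=∅ (_ , x∈p∩q⁺ (x∈S , x∈T))
    adjacent-to-T : _ ∈ neighbours T
    adjacent-to-T with walk-enters w (disjoint a∈S) b∈T
    ... | x , y , x∈ , x∉T , y∈T , x~y
      with x∈p∪q∪⁅y⁆⇒x≡y x∈ (λ x∈S → no-edge x y x∈S y∈T x~y) x∉T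
    ... | refl = ∈-neighbours⁺ y∈T x~y
    adjacent-to-S : _ ∈ neighbours S
    adjacent-to-S with walk-enters (reverse w) (λ b∈S → disjoint b∈S b∈T) a∈S
    ... | x , y , x∈ , x∉S , y∈S , x~y
      with x∈p∪q∪⁅y⁆⇒x≡y x∈ x∉S (λ x∈T → no-edge y x y∈S x∈T (Adj-sym x~y))
    ... | refl = ∈-neighbours⁺ y∈S x~y

lemma6 : ∀ {n} (G : Graph n) (s t : Fin n) (V′ S T : Subset n) →
    IsCertificate G s t V′ S T →
    ∃[ Z ] (IsMinimalSeparator G s t Z × V′ ⊆ Z)
lemma6 {n} G s t V′ S T (s∈S , t∈T , S∩T=∅ , S-connected , T-connected , no-edge , V′-links) =
  Z , far-component-boundary-minimal G t∈far s∈S S-connected , V′⊆Z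
  where
  C Z : Subset n
  C = component G (far G S) t
  Z = boundary G C

  T⊆far : T ⊆ far G S
  T⊆far = separated⊆far G S∩T=∅ no-edge
  t∈far : t ∈ far G S
  t∈far = T⊆far t∈T
  T⊆C : T ⊆ C
  T⊆C = connected⊆component G T-connected T⊆far t∈T

  V′⊆Z : V′ ⊆ Z
  V′⊆Z {v} v∈V′ with linking-vertex-adjacent G S∩T=∅ no-edge s∈S t∈T
                       (V′-links v v∈V′ (x∈p∪q⁺ (inj₁ s∈S)) (x∈p∪q⁺ (inj₂ (x∈p∪q⁺ (inj₁ t∈T)))))
  ... | v∈NS , v∈NT =
    x∈p∩q⁺ (far-component-avoids G t∈far (x∈p∪q⁺ (inj₂ v∈NS)) , neighbours-mono G T⊆C v∈NT)
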